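{- Let $G=(V,E)$ be a finite simple graph of order $n$ and let $T=n-1$. Let $(s,x,y,z)$ be an optimal solution of the model that minimizes $\sum_{v\in V}s_v+\frac{z}{2T}$ subject to $s\in\{0,1\}^V$, $x\in\{0,\ldots,T\}^V$, $y\in\{0,1\}^A$, $z\in\{0,\ldots,T\}$ and (i) $s_v+\sum_{a=(u,v)\in A}y_a=1$ for all $v\in V$; (ii) $x_u-x_v+(T+1)y_a\le T$ for all $a=(u,v)\in A$; (iii) $x_w-x_v+(T+1)y_a\le T$ for all $a=(u,v)\in A$, $w\in N(u)\setminus\{v\}$; (iv) $x_v\le z$ for all $v\in V$. Then $C=\{v\in V: s_v=1\}$ is a minimum zero forcing set of $G$ such that $\operatorname{pt}(G)=\operatorname{pt}(G,C)=z$.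
   Context: $N(u)$ is the neighborhood of $u$; $A$ contains both arcs $(u,v),(v,u)$ for each edge $\{u,v\}$. Standard zero forcing rule: a filled vertex $u$ forces a non-filled vertex $v$ if $v$ is the only non-filled neighbor of $u$. A zero forcing set is a set $C$ from which all vertices eventually become filled; a minimum zero forcing set has minimum cardinality $Z(G)$. $\operatorname{pt}(G,C)$ is the number of time steps needed to fill all vertices from $C$ when at each time step all possible forces are applied simultaneously. The minimum propagation time is $\operatorname{pt}(G)=\min\{\operatorname{pt}(G,C): C \text{ a zero forcing set}, |C|=Z(G)\}$. -}

module Defs where

open import Data.Nat using (ℕ; zero; suc; _+_; _*_; _∸_; _≤_; _<_)
open import Data.Bool using (Bool; true; false; _∧_; _∨_; not; if_then_else_)
open import Data.Fin using (Fin; _≟_)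
open import Data.List using (List; map; foldr; allFin)
open import Data.Bool.ListAction using (any; all)
open import Data.Product using (_×_; Σ; ∃)
open import Relation.Nullary.Decidable using (⌊_⌋)
open import Relation.Binary.PropositionalEquality using (_≡_)

record SimpleGraph (n : ℕ) : Set where
  field
    adj       : Fin n → Fin n → Bool
    symmetric : ∀ u v → adj u v ≡ adj v u
    loopless  : ∀ v → adj v v ≡ false
open SimpleGraph public

Σᵥ : {n : ℕ} → (Fin n → ℕ) → ℕ
Σᵥ {n} f = foldr _+_ 0 (map f (allFin n))

VSet : ℕ → Set
VSet n = Fin n → Bool

card : {n : ℕ} → VSet n → ℕ
card S = Σᵥ (λ v → if S v then 1 else 0)

_==_ : {n : ℕ} → Fin n → Fin n → Bool
v == w = ⌊ v ≟ w ⌋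

forces : {n : ℕ} → SimpleGraph n → VSet n → Fin n → Fin n → Bool
forces {n} G S u v =
  S u ∧ adj G u v ∧ not (S v) ∧
  all (λ w → not (adj G u w) ∨ S w ∨ (w == v)) (allFin n)

step : {n : ℕ} → SimpleGraph n → VSet n → VSet n
step {n} G S v = S v ∨ any (λ u → forces G S u v) (allFin n)

filledAfter : {n : ℕ} → SimpleGraph n → VSet n → ℕ → VSet n
filledAfter G C zero    = C
filledAfter G C (suc k) = step G (filledAfter G C k)

AllFilled : {n : ℕ} → VSet n → Set
AllFilled S = ∀ v → S v ≡ true

IsZeroForcingSet : {n : ℕ} → SimpleGraph n → VSet n → Set
IsZeroForcingSet G C = ∃ λ k → AllFilled (filledAfter G C k)

IsMinimumZeroForcingSet : {n : ℕ} → SimpleGraph n → VSet n → Set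
IsMinimumZeroForcingSet G C =
  IsZeroForcingSet G C × (∀ D → IsZeroForcingSet G D → card C ≤ card D)

PropTimeIs : {n : ℕ} → SimpleGraph n → VSet n → ℕ → Set
PropTimeIs G C t =
  AllFilled (filledAfter G C t) × (∀ k → AllFilled (filledAfter G C k) → t ≤ k)

MinPropTimeIs : {n : ℕ} → SimpleGraph n → ℕ → Set
MinPropTimeIs G t =
  (∃ λ D → IsMinimumZeroForcingSet G D × PropTimeIs G D t) ×
  (∀ D → IsMinimumZeroForcingSet G D → ∀ k → AllFilled (filledAfter G D k) → t ≤ k)

-- The integer program.  T = n - 1.  Arcs are ordered pairs (u,v) with adj u v.
-- y is recorded on all ordered pairs but forced to 0 off the arc set A,
-- so it is exactly an element of {0,1}^A.
record Solution (n : ℕ) : Set where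
  field
    s : Fin n → ℕ
    x : Fin n → ℕ
    y : Fin n → Fin n → ℕ
    z : ℕ
open Solution public

T : ℕ → ℕ
T n = n ∸ 1

record Feasible {n : ℕ} (G : SimpleGraph n) (sol : Solution n) : Set where
  field
    s-bin  : ∀ v → s sol v ≤ 1
    x-rng  : ∀ v → x sol v ≤ T n
    y-bin  : ∀ u v → adj G u v ≡ true → y sol u v ≤ 1
    y-offA : ∀ u v → adj G u v ≡ false → y sol u v ≡ 0
    z-rng  : z sol ≤ T n
    c-i    : ∀ v → s sol v + Σᵥ (λ u → if adj G u v then y sol u v else 0) ≡ 1
    -- (ii) x_u - x_v + (T+1) y_a ≤ T   (rearranged over ℕ)
    c-ii   : ∀ u v → adj G u v ≡ true →
             x sol u + suc (T n) * y sol u v ≤ T n + x sol v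
    c-iii  : ∀ u v w → adj G u v ≡ true → adj G u w ≡ true → (w == v) ≡ false →
             x sol w + suc (T n) * y sol u v ≤ T n + x sol v
    c-iv   : ∀ v → x sol v ≤ z sol

-- Objective Σ s_v + z/(2T), multiplied by the positive constant 2T
-- (this does not change the set of minimisers when T > 0).
scaledObjective : {n : ℕ} → Solution n → ℕ
scaledObjective {n} sol = 2 * T n * Σᵥ (s sol) + z sol

Optimal : {n : ℕ} → SimpleGraph n → Solution n → Set
Optimal G sol =
  Feasible G sol × (∀ sol′ → Feasible G sol′ → scaledObjective sol ≤ scaledObjective sol′)

supportSet : {n : ℕ} → Solution n → VSet n
supportSet sol v = ⌊ Data.Nat._≟_ (s sol v) 1 ⌋

-- A feasible solution describes a forcing process: s marks the initial set C, y(u,v) = 1 says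
-- that u forces v, and (ii)-(iii) make u and its other neighbours filled strictly before time
-- x(v).  By induction on time every v is filled after x(v) ≤ z steps, so C is a zero forcing set
-- with pt(G,C) ≤ z.  Conversely, a zero forcing set D that fills G in k ≤ T steps yields a
-- feasible solution of scaled objective 2T·|D| + k (x = filling times, y = one chosen force into
-- each v ∉ D), and every zero forcing set fills G within T = n - 1 steps, since each step before
-- completion fills a new vertex.  As z ≤ T < 2T, an optimum minimises |C| first and then z.

module Submission where

open import Defs
open import Data.Nat using (ℕ; zero; suc; _+_; _*_; _≤_; _<_; z≤n; s≤s; z<s; pred)
open import Data.Nat.Properties
open import Data.Bool using (Bool; true; false; not; _∧_; _∨_; if_then_else_)
import Data.Bool as Bool
open import Data.Bool.Properties using (T-≡; ∨-zeroʳ; ¬-not)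
open import Data.Bool.ListAction using (any; all)
open import Data.Fin using (Fin; zero; suc)
import Data.Fin.Properties as Fin
open import Data.List using (foldr; allFin)
open import Data.List.Properties using (map-tabulate; map-cong)
import Data.List.Relation.Unary.Any.Properties as Any
import Data.List.Relation.Unary.All.Properties as All
open import Data.Product using (_×_; _,_; ∃; proj₁; proj₂; map₂)
open import Data.Sum using (_⊎_; inj₁; inj₂)
open import Data.Empty using (⊥-elim)
open import Function using (_∘_; id; Equivalence)
open import Relation.Nullary using (¬_; Dec; yes; no; does; contradiction)
open import Relation.Nullary.Decidable using (⌊_⌋; map′; dec-true; dec-false; isYes≗does; _×-dec_)
open import Relation.Binary.PropositionalEquality

Σᵥ-suc : ∀ {n} (f : Fin (suc n) → ℕ) → Σᵥ f ≡ f zero + Σᵥ (f ∘ suc)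
Σᵥ-suc f = cong (λ xs → f zero + foldr _+_ 0 xs)
  (trans (map-tabulate suc f) (sym (map-tabulate id (f ∘ suc))))

Σᵥ-cong : ∀ {n} {f g : Fin n → ℕ} → (∀ v → f v ≡ g v) → Σᵥ f ≡ Σᵥ g
Σᵥ-cong {n} f≗g = cong (foldr _+_ 0) (map-cong f≗g (allFin n))

Σᵥ-zero : ∀ {n} {f : Fin n → ℕ} → (∀ v → f v ≡ 0) → Σᵥ f ≡ 0
Σᵥ-zero {zero}          f≗0 = refl
Σᵥ-zero {suc n} {f = f} f≗0 =
  trans (Σᵥ-suc f) (cong₂ _+_ (f≗0 zero) (Σᵥ-zero (f≗0 ∘ suc)))

Σᵥ-const : ∀ {n} c → Σᵥ {n} (λ _ → c) ≡ n * c
Σᵥ-const {zero}  c = refl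
Σᵥ-const {suc n} c = trans (Σᵥ-suc {n} (λ _ → c)) (cong (c +_) (Σᵥ-const {n} c))

Σᵥ-mono-≤ : ∀ {n} {f g : Fin n → ℕ} → (∀ v → f v ≤ g v) → Σᵥ f ≤ Σᵥ g
Σᵥ-mono-≤ {zero}                  f≤g = z≤n
Σᵥ-mono-≤ {suc n} {f = f} {g} f≤g rewrite Σᵥ-suc f | Σᵥ-suc g =
  +-mono-≤ (f≤g zero) (Σᵥ-mono-≤ (f≤g ∘ suc))

Σᵥ-mono-< : ∀ {n} {f g : Fin n → ℕ} → (∀ v → f v ≤ g v) → ∀ w → f w < g w → Σᵥ f < Σᵥ g
Σᵥ-mono-< {suc n} {f = f} {g} f≤g zero fw<gw rewrite Σᵥ-suc f | Σᵥ-suc g =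
  +-mono-<-≤ fw<gw (Σᵥ-mono-≤ (f≤g ∘ suc))
Σᵥ-mono-< {suc n} {f = f} {g} f≤g (suc w) fw<gw rewrite Σᵥ-suc f | Σᵥ-suc g =
  +-mono-≤-< (f≤g zero) (Σᵥ-mono-< (f≤g ∘ suc) w fw<gw)

Σᵥ-concentrated : ∀ {n} {f : Fin n → ℕ} w → (∀ u → u ≢ w → f u ≡ 0) → Σᵥ f ≡ f w
Σᵥ-concentrated {suc n} {f} zero f≡0 = begin
  Σᵥ f                    ≡⟨ Σᵥ-suc f ⟩
  f zero + Σᵥ (f ∘ suc)   ≡⟨ cong (f zero +_) (Σᵥ-zero (λ u → f≡0 (suc u) λ ())) ⟩
  f zero + 0              ≡⟨ +-identityʳ (f zero) ⟩
  f zero                  ∎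
  where open ≡-Reasoning
Σᵥ-concentrated {suc n} {f} (suc w) f≡0 = begin
  Σᵥ f                    ≡⟨ Σᵥ-suc f ⟩
  f zero + Σᵥ (f ∘ suc)   ≡⟨ cong₂ _+_ (f≡0 zero λ ())
                                       (Σᵥ-concentrated w λ u u≢w → f≡0 (suc u) (u≢w ∘ Fin.suc-injective)) ⟩
  f (suc w)               ∎
  where open ≡-Reasoning

Σᵥ-pos : ∀ {n} (f : Fin n → ℕ) → 0 < Σᵥ f → ∃ λ v → 0 < f v
Σᵥ-pos f 0<Σf with Fin.all? (λ v → f v ≟ 0)
... | yes f≗0 = contradiction (Σᵥ-zero f≗0) (>⇒≢ 0<Σf)
... | no ¬f≗0 = map₂ n≢0⇒n>0 (Fin.¬∀⟶∃¬ _ _ (λ v → f v ≟ 0) ¬f≗0)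

module _ {n : ℕ} (p : Fin n → Bool) where

  any-allFin⁺ : ∀ u → p u ≡ true → any p (allFin n) ≡ true
  any-allFin⁺ u pu =
    Equivalence.to T-≡ (Any.any⁺ p (Any.tabulate⁺ u (Equivalence.from T-≡ pu)))

  any-allFin⁻ : any p (allFin n) ≡ true → ∃ λ u → p u ≡ true
  any-allFin⁻ any≡true = map₂ (Equivalence.to T-≡)
    (Any.tabulate⁻ (Any.any⁻ p (allFin n) (Equivalence.from T-≡ any≡true)))

  all-allFin⁺ : (∀ u → p u ≡ true) → all p (allFin n) ≡ true
  all-allFin⁺ p≗true =
    Equivalence.to T-≡ (All.all⁻ p (All.tabulate⁺ (Equivalence.from T-≡ ∘ p≗true)))

  all-allFin⁻ : all p (allFin n) ≡ true → ∀ u → p u ≡ true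
  all-allFin⁻ all≡true u = Equivalence.to T-≡
    (All.tabulate⁻ (All.all⁺ p (allFin n) (Equivalence.from T-≡ all≡true)) u)

∧-true⁺ : ∀ {a b} → a ≡ true → b ≡ true → a ∧ b ≡ true
∧-true⁺ refl refl = refl

∧-true⁻ : ∀ {a b} → a ∧ b ≡ true → a ≡ true × b ≡ true
∧-true⁻ {true} b≡true = refl , b≡true

not-true⁻ : ∀ {a} → not a ≡ true → a ≡ false
not-true⁻ {false} refl = refl

clause⁺ : ∀ a b c → (a ≡ true → c ≡ false → b ≡ true) → not a ∨ b ∨ c ≡ true
clause⁺ false b     c     a⇒b = refl
clause⁺ true  b     true  a⇒b = ∨-zeroʳ b
clause⁺ true  b     false a⇒b = cong (_∨ false) (a⇒b refl refl)

clause⁻ : ∀ {a b c} → not a ∨ b ∨ c ≡ true → a ≡ true → c ≡ false → b ≡ true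
clause⁻ {true} {true} _ refl refl = refl

𝟙 : Bool → ℕ
𝟙 b = if b then 1 else 0

_⊆_ : ∀ {n} → VSet n → VSet n → Set
S ⊆ S′ = ∀ v → S v ≡ true → S′ v ≡ true

⊆-or-new : ∀ {n} (S S′ : VSet n) → S′ ⊆ S ⊎ ∃ λ w → S′ w ≡ true × S w ≡ false
⊆-or-new S S′ with Fin.any? (λ w → (S′ w Bool.≟ true) ×-dec (S w Bool.≟ false))
... | yes new  = inj₂ new
... | no ¬new  = inj₁ old
  where
    old : S′ ⊆ S
    old w S′w with S w in Sw
    ... | true  = refl
    ... | false = contradiction (w , S′w , Sw) ¬new

𝟙≤1 : ∀ b → 𝟙 b ≤ 1
𝟙≤1 false = z≤n
𝟙≤1 true  = ≤-refl

𝟙+𝟙[not] : ∀ b → 𝟙 b + 𝟙 (not b) ≡ 1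
𝟙+𝟙[not] false = refl
𝟙+𝟙[not] true  = refl

𝟙-mono : ∀ a b → (a ≡ true → b ≡ true) → 𝟙 a ≤ 𝟙 b
𝟙-mono false b    _   = z≤n
𝟙-mono true  b    a⇒b rewrite a⇒b refl = ≤-refl

card-mono : ∀ {n} (S S′ : VSet n) → S ⊆ S′ → card S ≤ card S′
card-mono S S′ S⊆S′ = Σᵥ-mono-≤ (λ v → 𝟙-mono (S v) (S′ v) (S⊆S′ v))

card-mono-< : ∀ {n} (S S′ : VSet n) → S ⊆ S′ → ∀ {w} → S w ≡ false → S′ w ≡ true → card S < card S′
card-mono-< S S′ S⊆S′ {w} Sw S′w = Σᵥ-mono-< (λ v → 𝟙-mono (S v) (S′ v) (S⊆S′ v)) w
  (subst₂ (λ a b → 𝟙 a < 𝟙 b) (sym Sw) (sym S′w) (n<1+n 0))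

card-⊤ : ∀ {n} → card {n} (λ _ → true) ≡ n
card-⊤ {n} = trans (Σᵥ-const {n} 1) (*-identityʳ n)

card-⊥ : ∀ {n} → card {n} (λ _ → false) ≡ 0
card-⊥ {n} = Σᵥ-zero {n} (λ _ → refl)

card-≤ : ∀ {n} (S : VSet n) → card S ≤ n
card-≤ {n} S = subst (card S ≤_) (card-⊤ {n}) (card-mono S (λ _ → true) (λ _ _ → refl))

card-pos : ∀ {n} (S : VSet n) {v} → S v ≡ true → 0 < card S
card-pos {n} S Sv = subst (_< card S) (card-⊥ {n}) (card-mono-< (λ _ → false) S (λ _ ()) refl Sv)

card>T⇒allFilled : ∀ {n} {S : VSet n} → T n < card S → AllFilled S
card>T⇒allFilled {n} {S} T<card v with S v in Sv
... | true  = refl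
... | false = ⊥-elim (<-irrefl refl (begin-strict
  card S              <⟨ subst (card S <_) (card-⊤ {n}) (card-mono-< S (λ _ → true) (λ _ _ → refl) Sv refl) ⟩
  n                   ≤⟨ m≤n+m∸n n 1 ⟩
  suc (T n)           ≤⟨ T<card ⟩
  card S              ∎))
  where open ≤-Reasoning

firstTrue : (ℕ → Bool) → ℕ → ℕ
firstTrue g zero    = 0
firstTrue g (suc b) = if g 0 then 0 else suc (firstTrue (g ∘ suc) b)

firstTrue-≤ : ∀ (g : ℕ → Bool) b → firstTrue g b ≤ b
firstTrue-≤ g zero    = z≤n
firstTrue-≤ g (suc b) with g 0
... | true  = z≤n
... | false = s≤s (firstTrue-≤ (g ∘ suc) b)

firstTrue-least : ∀ (g : ℕ → Bool) b {t} → g t ≡ true → firstTrue g b ≤ t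
firstTrue-least g zero    gt = z≤n
firstTrue-least g (suc b) {t} gt with g 0 in g0 | t
... | true  | _     = z≤n
... | false | zero  = contradiction (trans (sym g0) gt) λ ()
... | false | suc t = s≤s (firstTrue-least (g ∘ suc) b gt)

firstTrue-minimal : ∀ (g : ℕ → Bool) b {t} → t < firstTrue g b → g t ≡ false
firstTrue-minimal g (suc b) {t} t<first with g 0 in g0 | t
... | false | zero  = g0
... | false | suc t = firstTrue-minimal (g ∘ suc) b (≤-pred t<first)

g[pred[firstTrue]]≡false : ∀ (g : ℕ → Bool) b → g 0 ≡ false → g (pred (firstTrue g b)) ≡ false
g[pred[firstTrue]]≡false g b g0 with firstTrue g b | firstTrue-minimal g b
... | zero  | _     = g0
... | suc t | below = below (n<1+n t)

firstTrue-true : ∀ (g : ℕ → Bool) b {t} → t ≤ b → g t ≡ true → g (firstTrue g b) ≡ true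
firstTrue-true g zero    z≤n gt = gt
firstTrue-true g (suc b) {t} t≤b gt with g 0 in g0 | t | t≤b
... | true  | _     | _         = g0
... | false | zero  | _         = contradiction (trans (sym g0) gt) λ ()
... | false | suc t | s≤s t≤b′  = firstTrue-true (g ∘ suc) b t≤b′ gt

pred<-of-change : ∀ (g : ℕ → Bool) t → g (pred t) ≡ false → g t ≡ true → pred t < t
pred<-of-change g zero    before after = contradiction (trans (sym before) after) λ ()
pred<-of-change g (suc t) before after = n<1+n t

==-refl : ∀ {n} (u : Fin n) → (u == u) ≡ true
==-refl u = trans (isYes≗does (u Fin.≟ u)) (dec-true (u Fin.≟ u) refl)

≢⇒==-false : ∀ {n} {u w : Fin n} → u ≢ w → (u == w) ≡ false
≢⇒==-false {u = u} {w} u≢w = trans (isYes≗does (u Fin.≟ w)) (dec-false (u Fin.≟ w) u≢w)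

witnessIndicator : ∀ {n} {P : Fin n → Set} → Dec (∃ P) → Fin n → ℕ
witnessIndicator (yes (w , _)) u = 𝟙 (u == w)
witnessIndicator (no _)        u = 0

witnessIndicator-cases : ∀ {n} {P : Fin n → Set} (d : Dec (∃ P)) u →
  witnessIndicator d u ≡ 0 ⊎ (witnessIndicator d u ≡ 1 × P u)
witnessIndicator-cases (no _)         u = inj₁ refl
witnessIndicator-cases (yes (w , Pw)) u with u Fin.≟ w
... | yes refl = inj₂ (refl , Pw)
... | no _     = inj₁ refl

witnessIndicator-≤1 : ∀ {n} {P : Fin n → Set} (d : Dec (∃ P)) u → witnessIndicator d u ≤ 1
witnessIndicator-≤1 (no _)        u = z≤n
witnessIndicator-≤1 (yes (w , _)) u = 𝟙≤1 (u == w)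

Σᵥ-witnessIndicator : ∀ {n} {P : Fin n → Set} (d : Dec (∃ P)) → Σᵥ (witnessIndicator d) ≡ 𝟙 (does d)
Σᵥ-witnessIndicator {n} (no _)        = Σᵥ-zero {n} (λ _ → refl)
Σᵥ-witnessIndicator     (yes (w , _)) =
  trans (Σᵥ-concentrated w λ u u≢w → cong 𝟙 (≢⇒==-false u≢w)) (cong 𝟙 (==-refl w))

≤1⇒≡0⊎≡1 : ∀ {m} → m ≤ 1 → m ≡ 0 ⊎ m ≡ 1
≤1⇒≡0⊎≡1 {zero}        _        = inj₁ refl
≤1⇒≡0⊎≡1 {suc zero}    _        = inj₂ refl
≤1⇒≡0⊎≡1 {suc (suc _)} (s≤s ())

≤1⇒≡𝟙[≡1] : ∀ {m} → m ≤ 1 → m ≡ 𝟙 ⌊ m ≟ 1 ⌋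
≤1⇒≡𝟙[≡1] {zero}        _        = refl
≤1⇒≡𝟙[≡1] {suc zero}    _        = refl
≤1⇒≡𝟙[≡1] {suc (suc _)} (s≤s ())

big-M-unit : ∀ (a m : ℕ) → a + suc m * 1 ≡ suc a + m
big-M-unit a m = trans (+-suc a (m * 1)) (cong (suc a +_) (*-identityʳ m))

big-M-active⇒< : ∀ {a b m y} → y ≡ 1 → a + suc m * y ≤ m + b → a < b
big-M-active⇒< {a} {b} {m} refl le =
  +-cancelʳ-≤ m (suc a) b (subst₂ _≤_ (big-M-unit a m) (+-comm m b) le)

<⇒big-M-active : ∀ {a b m y} → y ≡ 1 → a < b → a + suc m * y ≤ m + b
<⇒big-M-active {a} {b} {m} refl a<b =
  subst₂ _≤_ (sym (big-M-unit a m)) (+-comm b m) (+-monoˡ-≤ m a<b)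

big-M-inactive : ∀ {a b m y} → y ≡ 0 → a ≤ m → a + suc m * y ≤ m + b
big-M-inactive {a} {b} {m} refl a≤m =
  subst (_≤ m + b) (sym (trans (cong (a +_) (*-zeroʳ m)) (+-identityʳ a)))
        (≤-trans a≤m (m≤m+n m b))

*-cancelˡ-≤-slack : ∀ {t a b r} → r < t → t * a ≤ t * b + r → a ≤ b
*-cancelˡ-≤-slack {t} {a} {b} {r} r<t ta≤tb+r with a ≤? b
... | yes a≤b = a≤b
... | no  a≰b = contradiction ta≤tb+r (<⇒≱ (begin-strict
  t * b + r   <⟨ +-monoʳ-< (t * b) r<t ⟩
  t * b + t   ≡⟨ trans (+-comm (t * b) t) (sym (*-suc t b)) ⟩
  t * suc b   ≤⟨ *-monoʳ-≤ t (≰⇒> a≰b) ⟩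
  t * a       ∎))
  where open ≤-Reasoning

module ZeroForcing {n : ℕ} (G : SimpleGraph n) where

  record Forcing (S : VSet n) (u v : Fin n) : Set where
    field
      filled       : S u ≡ true
      adjacent     : adj G u v ≡ true
      unfilled     : S v ≡ false
      othersFilled : ∀ w → adj G u w ≡ true → (w == v) ≡ false → S w ≡ true
  open Forcing public

  forces⁺ : ∀ {S u v} → Forcing S u v → forces G S u v ≡ true
  forces⁺ {S} {u} {v} f =
    ∧-true⁺ (filled f) (∧-true⁺ (adjacent f) (∧-true⁺ (cong not (unfilled f))
      (all-allFin⁺ _ λ w → clause⁺ (adj G u w) (S w) (w == v) (othersFilled f w))))

  forces⁻ : ∀ {S u v} → forces G S u v ≡ true → Forcing S u v
  forces⁻ e =
    let Su  , e₁ = ∧-true⁻ e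
        auv , e₂ = ∧-true⁻ e₁
        Sv  , e₃ = ∧-true⁻ e₂
    in record { filled = Su ; adjacent = auv ; unfilled = not-true⁻ Sv
              ; othersFilled = λ w → clause⁻ (all-allFin⁻ _ e₃ w) }

  forcing? : ∀ S u v → Dec (Forcing S u v)
  forcing? S u v = map′ forces⁻ forces⁺ (forces G S u v Bool.≟ true)

  step-inflationary : ∀ S → S ⊆ step G S
  step-inflationary S v Sv = cong (_∨ any (λ u → forces G S u v) (allFin n)) Sv

  step-of-unfilled : ∀ S {v} → S v ≡ false → step G S v ≡ any (λ u → forces G S u v) (allFin n)
  step-of-unfilled S {v} Sv = cong (_∨ any (λ u → forces G S u v) (allFin n)) Sv

  step⁺ : ∀ {S u v} → Forcing S u v → step G S v ≡ true
  step⁺ {S} {u} f = trans (step-of-unfilled S (unfilled f)) (any-allFin⁺ _ u (forces⁺ f))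

  step⁻ : ∀ {S v} → step G S v ≡ true → S v ≡ true ⊎ ∃ λ u → Forcing S u v
  step⁻ {S} {v} e with S v Bool.≟ true
  ... | yes Sv  = inj₁ Sv
  ... | no  ¬Sv = inj₂ (map₂ forces⁻ (any-allFin⁻ _ (trans (sym (step-of-unfilled S (¬-not ¬Sv))) e)))

  step-forced : ∀ {S u v} → S u ≡ true → adj G u v ≡ true →
                (∀ w → adj G u w ≡ true → (w == v) ≡ false → S w ≡ true) → step G S v ≡ true
  step-forced {S} {u} {v} Su auv others with S v Bool.≟ true
  ... | yes Sv  = step-inflationary S v Sv
  ... | no  ¬Sv = step⁺ record { filled = Su ; adjacent = auv ; unfilled = ¬-not ¬Sv
                               ; othersFilled = others }

  step-mono : ∀ {S S′} → S ⊆ S′ → step G S ⊆ step G S′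
  step-mono {S} {S′} S⊆S′ v e with step⁻ {S} e
  ... | inj₁ Sv      = step-inflationary S′ v (S⊆S′ v Sv)
  ... | inj₂ (u , f) = step-forced (S⊆S′ u (filled f)) (adjacent f)
                                   (λ w auw w≢v → S⊆S′ w (othersFilled f w auw w≢v))

  module _ (D : VSet n) where

    private
      F : ℕ → VSet n
      F = filledAfter G D

    filledAfter-mono : ∀ {j} k → j ≤ k → F j ⊆ F k
    filledAfter-mono zero    z≤n   v Dv = Dv
    filledAfter-mono (suc k) j≤1+k v e with m≤n⇒m<n∨m≡n j≤1+k
    ... | inj₁ j<1+k = step-inflationary (F k) v (filledAfter-mono k (≤-pred j<1+k) v e)
    ... | inj₂ refl  = e

    filledAfter-stalls : ∀ {j} → F (suc j) ⊆ F j → ∀ m → F (m + j) ⊆ F j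
    filledAfter-stalls stall zero    v e = e
    filledAfter-stalls stall (suc m) v e = stall v (step-mono (filledAfter-stalls stall m) v e)

    stalled⇒allFilled : IsZeroForcingSet G D → ∀ j → F (suc j) ⊆ F j → AllFilled (F j)
    stalled⇒allFilled (k , done) j stall v =
      filledAfter-stalls stall k v (filledAfter-mono (k + j) (m≤m+n k j) v (done v))

    progress : IsZeroForcingSet G D → ∀ j → AllFilled (F j) ⊎ j < card (F j)
    progress zfs zero with Fin.any? (λ v → D v Bool.≟ true)
    ... | yes (v , Dv) = inj₂ (card-pos D Dv)
    ... | no  D≡∅      = inj₁ (stalled⇒allFilled zfs 0 stuck)
      where
        stuck : step G D ⊆ D
        stuck v e with step⁻ {D} e
        ... | inj₁ Dv      = Dv
        ... | inj₂ (u , f) = contradiction (u , filled f) D≡∅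
    progress zfs (suc j) with progress zfs j | ⊆-or-new (F j) (F (suc j))
    ... | inj₁ done   | _                    = inj₁ (λ v → step-inflationary (F j) v (done v))
    ... | inj₂ _      | inj₁ stall           =
      inj₁ (λ v → step-inflationary (F j) v (stalled⇒allFilled zfs j stall v))
    ... | inj₂ j<card | inj₂ (w , new , old) =
      inj₂ (≤-<-trans j<card (card-mono-< (F j) (F (suc j)) (step-inflationary (F j)) old new))

    allFilled-by-T : IsZeroForcingSet G D → AllFilled (F (T n))
    allFilled-by-T zfs with progress zfs (T n)
    ... | inj₁ done   = done
    ... | inj₂ T<card = card>T⇒allFilled T<card

    zeroForcingSet-nonempty : IsZeroForcingSet G D → Fin n → 0 < card D
    zeroForcingSet-nonempty zfs v with progress zfs 0
    ... | inj₁ done   = card-pos D (done v)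
    ... | inj₂ 0<card = 0<card

    newly-filled⇒forced : ∀ t {v} → F (pred t) v ≡ false → F t v ≡ true → ∃ λ u → Forcing (F (pred t)) u v
    newly-filled⇒forced zero    before after = contradiction (trans (sym before) after) λ ()
    newly-filled⇒forced (suc t) before after with step⁻ after
    ... | inj₁ filled = contradiction (trans (sym before) filled) λ ()
    ... | inj₂ forcer = forcer

module SolutionOfForcingProcess {n : ℕ} (G : SimpleGraph n) (D : VSet n) (k : ℕ)
                                (done : AllFilled (filledAfter G D k)) where
  open ZeroForcing G

  F : ℕ → VSet n
  F = filledAfter G D

  fillTime : Fin n → ℕ
  fillTime v = firstTrue (λ t → F t v) k

  filled-at-fillTime : ∀ v → F (fillTime v) v ≡ true
  filled-at-fillTime v = firstTrue-true (λ t → F t v) k ≤-refl (done v)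

  fillTime-least : ∀ {t v} → F t v ≡ true → fillTime v ≤ t
  fillTime-least {v = v} = firstTrue-least (λ t → F t v) k

  -- u forces v in the step that fills v; for v ∈ D that "step" is pred 0 = 0, where nothing forces v.
  Forcer : Fin n → Fin n → Set
  Forcer v u = Forcing (F (pred (fillTime v))) u v

  forcer? : ∀ v → Dec (∃ (Forcer v))
  forcer? v = Fin.any? (λ u → forcing? (F (pred (fillTime v))) u v)

  forcingArc : Fin n → Fin n → ℕ
  forcingArc u v = witnessIndicator (forcer? v) u

  solution : Solution n
  solution = record { s = 𝟙 ∘ D ; x = fillTime ; y = forcingArc ; z = k }

  forcer-earlier : ∀ {u v} → Forcer v u →
                   fillTime u < fillTime v ×
                   (∀ w → adj G u w ≡ true → (w == v) ≡ false → fillTime w < fillTime v)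
  forcer-earlier {u} {v} f =
      ≤-<-trans (fillTime-least (filled f)) earlier
    , λ w auw w≢v → ≤-<-trans (fillTime-least (othersFilled f w auw w≢v)) earlier
    where
      earlier : pred (fillTime v) < fillTime v
      earlier = pred<-of-change (λ t → F t v) (fillTime v) (unfilled f) (filled-at-fillTime v)

  has-forcer≡not-initial : ∀ v → does (forcer? v) ≡ not (D v)
  has-forcer≡not-initial v with D v Bool.≟ true
  ... | yes Dv  = trans (dec-false (forcer? v) no-forcer) (cong not (sym Dv))
    where
      no-forcer : ¬ ∃ (Forcer v)
      no-forcer (u , f) = contradiction
        (trans (sym (unfilled f)) (filledAfter-mono D (pred (fillTime v)) z≤n v Dv)) λ ()
  ... | no  ¬Dv = trans (dec-true (forcer? v) (newly-filled⇒forced D (fillTime v) before (filled-at-fillTime v)))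
                        (cong not (sym (¬-not ¬Dv)))
    where
      before : F (pred (fillTime v)) v ≡ false
      before = g[pred[firstTrue]]≡false (λ t → F t v) k (¬-not ¬Dv)

  arc-constraint : ∀ {u v a} → a ≤ T n → (Forcer v u → a < fillTime v) →
                   a + suc (T n) * forcingArc u v ≤ T n + fillTime v
  arc-constraint {u} {v} a≤T a<x with witnessIndicator-cases (forcer? v) u
  ... | inj₁ y≡0       = big-M-inactive y≡0 a≤T
  ... | inj₂ (y≡1 , f) = <⇒big-M-active y≡1 (a<x f)

  off-arc-vanishes : ∀ {u v} → adj G u v ≡ false → forcingArc u v ≡ 0
  off-arc-vanishes {u} {v} ¬auv with witnessIndicator-cases (forcer? v) u
  ... | inj₁ y≡0     = y≡0
  ... | inj₂ (_ , f) = contradiction (trans (sym ¬auv) (adjacent f)) λ ()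

  s+arcsInto≡1 : ∀ v → 𝟙 (D v) + Σᵥ (λ u → if adj G u v then forcingArc u v else 0) ≡ 1
  s+arcsInto≡1 v = begin
    𝟙 (D v) + Σᵥ (λ u → if adj G u v then forcingArc u v else 0) ≡⟨ cong (𝟙 (D v) +_) (Σᵥ-cong drop-guard) ⟩
    𝟙 (D v) + Σᵥ (witnessIndicator (forcer? v))                  ≡⟨ cong (𝟙 (D v) +_) (Σᵥ-witnessIndicator (forcer? v)) ⟩
    𝟙 (D v) + 𝟙 (does (forcer? v))                               ≡⟨ cong (λ b → 𝟙 (D v) + 𝟙 b) (has-forcer≡not-initial v) ⟩
    𝟙 (D v) + 𝟙 (not (D v))                                      ≡⟨ 𝟙+𝟙[not] (D v) ⟩
    1                                                            ∎
    where
      open ≡-Reasoning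
      drop-guard : ∀ u → (if adj G u v then forcingArc u v else 0) ≡ forcingArc u v
      drop-guard u with adj G u v in auv
      ... | true  = refl
      ... | false = sym (off-arc-vanishes auv)

  feasible : k ≤ T n → Feasible G solution
  feasible k≤T = record
    { s-bin  = 𝟙≤1 ∘ D
    ; x-rng  = x-rng
    ; y-bin  = λ u v _ → witnessIndicator-≤1 (forcer? v) u
    ; y-offA = λ u v → off-arc-vanishes
    ; z-rng  = k≤T
    ; c-i    = s+arcsInto≡1
    ; c-ii   = λ u v _ → arc-constraint (x-rng u) (proj₁ ∘ forcer-earlier)
    ; c-iii  = λ u v w _ auw w≢v → arc-constraint (x-rng w) (λ f → proj₂ (forcer-earlier f) w auw w≢v)
    ; c-iv   = λ v → firstTrue-≤ (λ t → F t v) k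
    }
    where
      x-rng : ∀ v → fillTime v ≤ T n
      x-rng v = ≤-trans (firstTrue-≤ (λ t → F t v) k) k≤T

forcingProcess⇒solution : ∀ {n} (G : SimpleGraph n) D k → AllFilled (filledAfter G D k) → k ≤ T n →
                          ∃ λ sol → Feasible G sol × scaledObjective sol ≡ 2 * T n * card D + k
forcingProcess⇒solution G D k done k≤T = solution , feasible k≤T , refl
  where open SolutionOfForcingProcess G D k done

module FeasibleSolution {n} {G : SimpleGraph n} {sol : Solution n} (feas : Feasible G sol) where
  open ZeroForcing G
  open Feasible feas

  Σs≡card-support : Σᵥ (s sol) ≡ card (supportSet sol)
  Σs≡card-support = Σᵥ-cong (λ v → ≤1⇒≡𝟙[≡1] (s-bin v))

  incomingArc : ∀ {v} → s sol v ≡ 0 →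
                ∃ λ u → adj G u v ≡ true × x sol u < x sol v ×
                        (∀ w → adj G u w ≡ true → (w == v) ≡ false → x sol w < x sol v)
  incomingArc {v} s≡0 with Σᵥ-pos arcsInto (subst (0 <_) (sym Σ≡1) z<s)
    where
      arcsInto : Fin n → ℕ
      arcsInto u = if adj G u v then y sol u v else 0
      Σ≡1 : Σᵥ arcsInto ≡ 1
      Σ≡1 = trans (cong (_+ Σᵥ arcsInto) (sym s≡0)) (c-i v)
  ... | u , 0<y with adj G u v in auv
  ...   | true  = u , auv , big-M-active⇒< y≡1 (c-ii u v auv)
                , λ w auw w≢v → big-M-active⇒< y≡1 (c-iii u v w auv auw w≢v)
    where y≡1 = ≤-antisym (y-bin u v auv) 0<y

  support-filled : ∀ t v → x sol v ≤ t → filledAfter G (supportSet sol) t v ≡ true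
  support-filled t v x≤t with ≤1⇒≡0⊎≡1 (s-bin v)
  ... | inj₂ s≡1 = filledAfter-mono (supportSet sol) t z≤n v (cong (λ m → ⌊ m ≟ 1 ⌋) s≡1)
  ... | inj₁ s≡0 with incomingArc s≡0 | t
  ...   | _ , _ , xu<xv , _         | zero   = contradiction (<-≤-trans xu<xv x≤t) λ ()
  ...   | u , auv , xu<xv , xw<xv   | suc t′ =
    step-forced (support-filled t′ u (≤-pred (<-≤-trans xu<xv x≤t))) auv
                (λ w auw w≢v → support-filled t′ w (≤-pred (<-≤-trans (xw<xv w auw w≢v) x≤t)))

module OptimalSolution {n} {G : SimpleGraph n} {sol : Solution n} (opt : Optimal G sol) where
  open FeasibleSolution (proj₁ opt)
  open Feasible (proj₁ opt)

  objective-≤ : ∀ {D k} → AllFilled (filledAfter G D k) → k ≤ T n →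
                2 * T n * card (supportSet sol) + z sol ≤ 2 * T n * card D + k
  objective-≤ {D} {k} done k≤T with forcingProcess⇒solution G D k done k≤T
  ... | sol′ , feas′ , obj≡ =
    subst₂ _≤_ (cong (λ c → 2 * T n * c + z sol) Σs≡card-support) obj≡ (proj₂ opt sol′ feas′)

  support-allFilled : AllFilled (filledAfter G (supportSet sol) (z sol))
  support-allFilled v = support-filled (z sol) v (c-iv v)

  support-fastest : ∀ {D k} → card D ≤ card (supportSet sol) → AllFilled (filledAfter G D k) → z sol ≤ k
  support-fastest {D} {k} D≤C done with k ≤? T n
  ... | yes k≤T = +-cancelˡ-≤ (2 * T n * card (supportSet sol)) (z sol) k
                    (≤-trans (objective-≤ done k≤T) (+-monoˡ-≤ k (*-monoʳ-≤ (2 * T n) D≤C)))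
  ... | no  k≰T = ≤-trans z-rng (<⇒≤ (≰⇒> k≰T))

-- For n ≤ 1 we have T = 0 and the objective ignores |C|; then |C| ≤ n ≤ |D| instead.
support-minimum : ∀ n (G : SimpleGraph n) sol → Optimal G sol →
                  ∀ D → IsZeroForcingSet G D → card (supportSet sol) ≤ card D
support-minimum zero          G sol opt D zfs = ≤-trans (card-≤ (supportSet sol)) z≤n
support-minimum (suc zero)    G sol opt D zfs =
  ≤-trans (card-≤ (supportSet sol)) (ZeroForcing.zeroForcingSet-nonempty G D zfs zero)
support-minimum (suc (suc m)) G sol opt D zfs =
  *-cancelˡ-≤-slack (m<m+n (suc m) z<s)
    (≤-trans (m≤m+n _ (z sol)) (objective-≤ (ZeroForcing.allFilled-by-T G D zfs) ≤-refl))
  where open OptimalSolution opt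

corollary3p4 : (n : ℕ) (G : SimpleGraph n) (sol : Solution n) →
    Optimal G sol →
    IsMinimumZeroForcingSet G (supportSet sol) ×
    MinPropTimeIs G (z sol) ×
    PropTimeIs G (supportSet sol) (z sol)
corollary3p4 n G sol opt =
  minimum , ((supportSet sol , minimum , propTime) , fastest-among-minimum) , propTime
  where
    open OptimalSolution opt

    minimum : IsMinimumZeroForcingSet G (supportSet sol)
    minimum = (z sol , support-allFilled) , support-minimum n G sol opt

    propTime : PropTimeIs G (supportSet sol) (z sol)
    propTime = support-allFilled , λ k → support-fastest ≤-refl

    fastest-among-minimum : ∀ D → IsMinimumZeroForcingSet G D →
                            ∀ k → AllFilled (filledAfter G D k) → z sol ≤ k
    fastest-among-minimum D (_ , D-minimum) k =
      support-fastest (D-minimum (supportSet sol) (proj₁ minimum))
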